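{- Let $\alpha\in2^\omega$ be proper. For all $n\ge2$: (i) $s^{\oplus_n}_\alpha\not\le_W(s_\alpha)^{n-1}$; (ii) $s^{\oplus_n}_\alpha\le_{sW}(s_\alpha)^n$ and $(s_\alpha)^n\not\le_W s^{\oplus_n}_\alpha$; in fact even $s_\alpha\times s_\alpha\not\le_W s^{\oplus_n}_\alpha$.
   Context: Cantor space $2^\omega$ carries the lexicographic order $<_{lex}$. For $\alpha\in2^\omega$, $s_\alpha(x)=0$ if $x<_{lex}\alpha$ and $1$ otherwise. A sequence is proper if it contains infinitely many $1$'s. $s^{\oplus_n}_\alpha\colon(2^\omega)^n\to\{0,1\}$ is $(x_1,\dots,x_n)\mapsto s_\alpha(x_1)\oplus\dots\oplus s_\alpha(x_n)$ (addition modulo 2). $(s_\alpha)^m$ is the $m$-fold product $(x_1,\dots,x_m)\mapsto(s_\alpha(x_1),\dots,s_\alpha(x_m))$. $f\le_W g$ means there are computable functionals $\Phi,\Psi$ with $f(x)=\Psi(x,g(\Phi(x)))$ for all $x$; $f\le_{sW}g$ means $f(x)=\Psi(g(\Phi(x)))$. -}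

module Defs where

open import Data.Nat using (ℕ; zero; suc; _≤_; _<_)
open import Data.Bool using (Bool; true; false; _xor_)
open import Data.Fin using (Fin; toℕ) renaming (zero to fzero; suc to fsuc)
open import Data.Vec using (Vec; []; _∷_; lookup)
open import Data.Vec.Functional as VF using ()
open import Data.Product using (Σ; _×_; ∃)
open import Data.Sum using (_⊎_)
open import Relation.Nullary using (¬_)
open import Relation.Binary.PropositionalEquality using (_≡_)

Cantor : Set
Cantor = ℕ → Bool

_<lex_ : Cantor → Cantor → Set
x <lex α = Σ ℕ λ k → (∀ i → i < k → x i ≡ α i) × (x k ≡ false) × (α k ≡ true)

Proper : Cantor → Set
Proper α = ∀ m → Σ ℕ λ k → (m ≤ k) × (α k ≡ true)

-- Problems with n Cantor-space inputs and m bits of output, given as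
-- relations (graphs). All problems here are total (classically).

Problem : ℕ → ℕ → Set₁
Problem n m = (Fin n → Cantor) → (Fin m → Bool) → Set

S : Cantor → Cantor → Bool → Set
S α x b = ((x <lex α) × (b ≡ false)) ⊎ ((¬ (x <lex α)) × (b ≡ true))

SPow : Cantor → (m : ℕ) → Problem m m
SPow α m x b = ∀ i → S α (x i) (b i)

xorAll : ∀ {n} → (Fin n → Bool) → Bool
xorAll b = VF.foldr _xor_ false b

SXor : Cantor → (n : ℕ) → Problem n 1
SXor α n x c = Σ (Fin n → Bool) λ b → (∀ i → S α (x i) (b i)) × (c fzero ≡ xorAll b)

-- Partial recursive functions relative to an oracle O : ℕ → ℕ → ℕ
-- (μ-recursive schemes with an extra oracle-query basic function).

data Code : ℕ → Set where
  cZ : ∀ {n} → Code n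
  cS : Code 1
  cP : ∀ {n} → Fin n → Code n
  cQ : Code 2
  cC : ∀ {n k} → Code k → Vec (Code n) k → Code n
  cR : ∀ {n} → Code n → Code (suc (suc n)) → Code (suc n)
  cM : ∀ {n} → Code (suc n) → Code n

mutual
  data Eval (O : ℕ → ℕ → ℕ) : ∀ {n} → Code n → Vec ℕ n → ℕ → Set where
    eZ : ∀ {n} {xs : Vec ℕ n} → Eval O cZ xs 0
    eS : ∀ {x} → Eval O cS (x ∷ []) (suc x)
    eP : ∀ {n} (i : Fin n) {xs : Vec ℕ n} → Eval O (cP i) xs (lookup xs i)
    eQ : ∀ {i j} → Eval O cQ (i ∷ j ∷ []) (O i j)
    eC : ∀ {n k} {f : Code k} {gs : Vec (Code n) k} {xs : Vec ℕ n} {vs : Vec ℕ k} {v} →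
         EvalAll O gs xs vs → Eval O f vs v → Eval O (cC f gs) xs v
    eR0 : ∀ {n} {f : Code n} {g : Code (suc (suc n))} {xs : Vec ℕ n} {v} →
          Eval O f xs v → Eval O (cR f g) (0 ∷ xs) v
    eRS : ∀ {n} {f : Code n} {g : Code (suc (suc n))} {y} {xs : Vec ℕ n} {u v} →
          Eval O (cR f g) (y ∷ xs) u → Eval O g (y ∷ u ∷ xs) v →
          Eval O (cR f g) (suc y ∷ xs) v
    eM : ∀ {n} {f : Code (suc n)} {xs : Vec ℕ n} {y} →
         Eval O f (y ∷ xs) 0 →
         (∀ z → z < y → Σ ℕ λ v → Eval O f (z ∷ xs) (suc v)) →
         Eval O (cM f) xs y

  data EvalAll (O : ℕ → ℕ → ℕ) : ∀ {n k} → Vec (Code n) k → Vec ℕ n → Vec ℕ k → Set where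
    [] : ∀ {n} {xs : Vec ℕ n} → EvalAll O [] xs []
    _∷_ : ∀ {n k} {g : Code n} {gs : Vec (Code n) k} {xs : Vec ℕ n} {v} {vs : Vec ℕ k} →
          Eval O g xs v → EvalAll O gs xs vs → EvalAll O (g ∷ gs) xs (v ∷ vs)

b2n : Bool → ℕ
b2n false = 0
b2n true  = 1

-- oracle for (x₀,…,x_{n-1}) : query (i , j) gives x_i(j) (and 0 if i ≥ n)
orc : ∀ {n} → (Fin n → Cantor) → ℕ → ℕ → ℕ
orc {zero}  x i       j = 0
orc {suc n} x zero    j = b2n (x fzero j)
orc {suc n} x (suc i) j = orc {n} (λ k → x (fsuc k)) i j

-- the empty oracle (used for reductions whose output map cannot see the input)
noOrc : ℕ → ℕ → ℕ
noOrc _ _ = 0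

bits : ∀ {l} → (Fin l → Bool) → Vec ℕ l
bits {zero}  b = []
bits {suc l} b = b2n (b fzero) ∷ bits (λ i → b (fsuc i))

Computes : ∀ {n k} → (Fin n → Cantor) → Code 2 → (Fin k → Cantor) → Set
Computes x e w = ∀ i j → Eval (orc x) e (toℕ i ∷ j ∷ []) (b2n (w i j))

-- Weihrauch reducibility (total Φ on the domain (2^ω)^n, partial Ψ that
-- must converge on all pairs (x , y) with y a g-solution of Φ(x)).

_≤W_ : ∀ {n m k l} → Problem n m → Problem k l → Set
_≤W_ {n} {m} {k} {l} f g =
  Σ (Code 2) λ eΦ → Σ (Code (suc l)) λ eΨ →
    ∀ (x : Fin n → Cantor) → Σ (Fin k → Cantor) λ w → Computes x eΦ w ×
      (∀ (y : Fin l → Bool) → g w y →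
        Σ (Fin m → Bool) λ z →
          (∀ j → Eval (orc x) eΨ (toℕ j ∷ bits y) (b2n (z j))) × f x z)

_≤sW_ : ∀ {n m k l} → Problem n m → Problem k l → Set
_≤sW_ {n} {m} {k} {l} f g =
  Σ (Code 2) λ eΦ → Σ (Code (suc l)) λ eΨ →
    ∀ (x : Fin n → Cantor) → Σ (Fin k → Cantor) λ w → Computes x eΦ w ×
      (∀ (y : Fin l → Bool) → g w y →
        Σ (Fin m → Bool) λ z →
          (∀ j → Eval noOrc eΨ (toℕ j ∷ bits y) (b2n (z j))) × f x z)

{-# OPTIONS --safe #-}
-- Weihrauch reductions are continuous: the instance Φ(x) and each output bit of Ψ(x, y) depend
-- only on a finite prefix of x (the use principle). Because α has infinitely many 1's, a
-- coordinate equal to α can be pushed below α by turning a 1 of α beyond any given use into a 0;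
-- the computations seen so far do not notice, while the value of s_α on that coordinate flips.
--
-- (i) Starting from (α, …, α), lower the n coordinates one after another. Each lowering flips
-- the parity, so the answer y of (s_α)^(n-1) must change; but a 0 of y is witnessed by a finite
-- prefix of Φ(x) and survives, so y loses a 1 at every step: n steps, only n-1 ones.
-- (ii) Writing α↓ for such lowered copies of α, the instances (α, α), (α↓, α), (α↓, α↓) need
-- pairwise different one-bit answers: the first output bit separates the first instance from the
-- other two, and the second output bit separates the last two.
-- The positive reduction just computes the parity of the n answers.
module Submission where

open import Defs
open import Data.Nat
  using (ℕ; zero; suc; _+_; _≤_; _<_; _⊔_; _∸_; z≤n; s≤s) renaming (_≟_ to _≟ℕ_)
open import Data.Nat.Properties
  using (≤-refl; ≤-trans; ≤-reflexive; <-≤-trans; <⇒≤; <⇒≱; <-irrefl; <-cmp; 0≢1+n; m<n⇒m<1+n;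
         m<1+n⇒m<n∨m≡n; m≤m⊔n; m≤n⊔m; m≤n+m; +-suc; +-monoˡ-≤; +-identityʳ)
open import Data.Bool using (Bool; true; false; not; _xor_)
open import Data.Bool.Properties using (not-¬; ¬-not; not-involutive; not-distribˡ-xor; not-distribʳ-xor)
import Data.Bool.Properties as Bool
open import Data.Fin using (Fin; toℕ; fromℕ<; _≟_) renaming (zero to fzero; suc to fsuc)
open import Data.Fin.Properties using (toℕ-fromℕ<; ¬∀⟶∃¬; sequence)
open import Data.Fin.Subset using (Subset; _∈_; _⊂_; ∣_∣)
open import Data.Fin.Subset.Properties using (∣p∣≤n; p⊂q⇒∣p∣<∣q∣)
open import Data.Vec using (Vec; []; _∷_; lookup; tabulate)
open import Data.Vec.Properties using (tabulate∘lookup; lookup∘tabulate; []=⇒lookup; lookup⇒[]=)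
open import Data.Vec.Functional using (updateAt)
open import Data.Vec.Functional.Properties using (updateAt-updates; updateAt-minimal)
open import Data.Product using (Σ; _×_; _,_; proj₁; proj₂; uncurry)
open import Data.Sum using (inj₁; inj₂)
open import Data.Empty using (⊥)
open import Effect.Monad using (RawMonad)
open import Function using (_∘_)
open import Relation.Binary.Definitions using (tri<; tri≈; tri>)
open import Relation.Binary.PropositionalEquality
  using (_≡_; _≢_; refl; sym; trans; cong; cong₂; subst; module ≡-Reasoning)
open import Relation.Nullary using (¬_; Dec; yes; no; contradiction)
open import Relation.Nullary.Decidable using (¬¬-excluded-middle)
open import Relation.Nullary.Negation using (¬¬-map; ¬¬-Monad)

private
  variable
    A I : Set
    u v : ℕ
    α : Cantor
    O : ℕ → ℕ → ℕ

infix 4 _≈⟨_⟩_ _≈[_]_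

_≈⟨_⟩_ : (ℕ → A) → ℕ → (ℕ → A) → Set
s ≈⟨ u ⟩ t = ∀ j → j < u → s j ≡ t j

_≈[_]_ : (I → ℕ → A) → ℕ → (I → ℕ → A) → Set
f ≈[ u ] g = ∀ i → f i ≈⟨ u ⟩ g i

≈⟨⟩-mono : {s t : ℕ → A} → u ≤ v → s ≈⟨ v ⟩ t → s ≈⟨ u ⟩ t
≈⟨⟩-mono u≤v s≈t j j<u = s≈t j (<-≤-trans j<u u≤v)

≈[]-mono : {f g : I → ℕ → A} → u ≤ v → f ≈[ v ] g → f ≈[ u ] g
≈[]-mono u≤v f≈g i = ≈⟨⟩-mono u≤v (f≈g i)

≈[]-trans : {f g h : I → ℕ → A} → f ≈[ u ] g → g ≈[ u ] h → f ≈[ u ] h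
≈[]-trans f≈g g≈h i j j<u = trans (f≈g i j j<u) (g≈h i j j<u)

Fin-upper-bound : ∀ {k} (f : Fin k → ℕ) → Σ ℕ λ U → ∀ i → f i ≤ U
Fin-upper-bound {zero}  f = 0 , λ ()
Fin-upper-bound {suc k} f with Fin-upper-bound (f ∘ fsuc)
... | U , f∘fsuc≤U = f fzero ⊔ U , λ { fzero → m≤m⊔n _ U ; (fsuc i) → ≤-trans (f∘fsuc≤U i) (m≤n⊔m _ U) }

<-upper-bound : ∀ d (f : ℕ → ℕ) → Σ ℕ λ U → ∀ j → j < d → f j ≤ U
<-upper-bound d f with Fin-upper-bound {d} (f ∘ toℕ)
... | U , ≤U = U , λ j j<d → subst (λ t → f t ≤ U) (toℕ-fromℕ< j<d) (≤U (fromℕ< j<d))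

mutual
  Eval-deterministic : ∀ {n} {e : Code n} {xs v v′} → Eval O e xs v → Eval O e xs v′ → v ≡ v′
  Eval-deterministic eZ eZ = refl
  Eval-deterministic eS eS = refl
  Eval-deterministic (eP i) (eP .i) = refl
  Eval-deterministic eQ eQ = refl
  Eval-deterministic (eC ds d) (eC ds′ d′) with EvalAll-deterministic ds ds′
  ... | refl = Eval-deterministic d d′
  Eval-deterministic (eR0 d) (eR0 d′) = Eval-deterministic d d′
  Eval-deterministic (eRS d e) (eRS d′ e′) with Eval-deterministic d d′
  ... | refl = Eval-deterministic e e′
  Eval-deterministic (eM {y = y} d below) (eM {y = y′} d′ below′) with <-cmp y y′
  ... | tri< y<y′ _ _ = contradiction (Eval-deterministic d (proj₂ (below′ y y<y′))) 0≢1+n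
  ... | tri≈ _ y≡y′ _ = y≡y′
  ... | tri> _ _ y′<y = contradiction (Eval-deterministic d′ (proj₂ (below y′ y′<y))) 0≢1+n

  EvalAll-deterministic : ∀ {n k} {es : Vec (Code n) k} {xs vs vs′} →
                          EvalAll O es xs vs → EvalAll O es xs vs′ → vs ≡ vs′
  EvalAll-deterministic [] [] = refl
  EvalAll-deterministic (d ∷ ds) (d′ ∷ ds′) =
    cong₂ _∷_ (Eval-deterministic d d′) (EvalAll-deterministic ds ds′)

Local : ((ℕ → ℕ → ℕ) → Set) → (ℕ → ℕ → ℕ) → Set
Local P O = Σ ℕ λ u → ∀ {O′} → O ≈[ u ] O′ → P O′

local-map : {P Q : (ℕ → ℕ → ℕ) → Set} → (∀ {O′} → P O′ → Q O′) → Local P O → Local Q O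
local-map f (u , near) = u , λ O≈O′ → f (near O≈O′)

local-× : {P Q : (ℕ → ℕ → ℕ) → Set} → Local P O → Local Q O → Local (λ O′ → P O′ × Q O′) O
local-× (u , nearP) (v , nearQ) =
  u ⊔ v , λ O≈O′ → nearP (≈[]-mono (m≤m⊔n u v) O≈O′) , nearQ (≈[]-mono (m≤n⊔m u v) O≈O′)

NonzeroBelow : (ℕ → ℕ → ℕ) → ∀ {n} → Code (suc n) → Vec ℕ n → ℕ → Set
NonzeroBelow O f xs y = ∀ z → z < y → Σ ℕ λ v → Eval O f (z ∷ xs) (suc v)

mutual
  Eval-local : ∀ {n} {e : Code n} {xs v} → Eval O e xs v → Local (λ O′ → Eval O′ e xs v) O
  Eval-local eZ = 0 , λ _ → eZ
  Eval-local eS = 0 , λ _ → eS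
  Eval-local (eP i) = 0 , λ _ → eP i
  Eval-local (eQ {i} {j}) =
    suc j , λ {O′} O≈O′ → subst (Eval O′ cQ (i ∷ j ∷ [])) (sym (O≈O′ i j ≤-refl)) eQ
  Eval-local (eC ds d) = local-map (uncurry eC) (local-× (EvalAll-local ds) (Eval-local d))
  Eval-local (eR0 d) = local-map eR0 (Eval-local d)
  Eval-local (eRS d e) = local-map (uncurry eRS) (local-× (Eval-local d) (Eval-local e))
  Eval-local (eM {y = y} d below) =
    local-map (uncurry eM) (local-× (Eval-local d) (NonzeroBelow-local y below))

  EvalAll-local : ∀ {n k} {es : Vec (Code n) k} {xs vs} →
                  EvalAll O es xs vs → Local (λ O′ → EvalAll O′ es xs vs) O
  EvalAll-local [] = 0 , λ _ → []
  EvalAll-local (d ∷ ds) = local-map (uncurry _∷_) (local-× (Eval-local d) (EvalAll-local ds))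

  NonzeroBelow-local : ∀ {n} {f : Code (suc n)} {xs} y →
                       NonzeroBelow O f xs y → Local (λ O′ → NonzeroBelow O′ f xs y) O
  NonzeroBelow-local zero _ = 0 , λ _ z ()
  NonzeroBelow-local {f = f} {xs} (suc y) below =
    local-map extend (local-× (NonzeroBelow-local y (λ z z<y → below z (m<n⇒m<1+n z<y)))
                              (Eval-local (proj₂ (below y ≤-refl))))
    where
    extend : ∀ {O′} → NonzeroBelow O′ f xs y × Eval O′ f (y ∷ xs) (suc (proj₁ (below y ≤-refl))) →
             NonzeroBelow O′ f xs (suc y)
    extend (below′ , d) z z<1+y with m<1+n⇒m<n∨m≡n z<1+y
    ... | inj₁ z<y = below′ z z<y
    ... | inj₂ refl = _ , d

orc-≈ : ∀ {n} {x x′ : Fin n → Cantor} → x ≈[ u ] x′ → orc x ≈[ u ] orc x′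
orc-≈ {n = zero}  x≈x′ i       j j<u = refl
orc-≈ {n = suc n} x≈x′ zero    j j<u = cong b2n (x≈x′ fzero j j<u)
orc-≈ {n = suc n} x≈x′ (suc i) j j<u = orc-≈ (x≈x′ ∘ fsuc) i j j<u

orc-lookup : ∀ {n} (x : Fin n → Cantor) i j → orc x (toℕ i) j ≡ b2n (x i j)
orc-lookup x fzero    j = refl
orc-lookup x (fsuc i) j = orc-lookup (x ∘ fsuc) i j

b2n-injective : ∀ {a b} → b2n a ≡ b2n b → a ≡ b
b2n-injective {false} {false} _ = refl
b2n-injective {true}  {true}  _ = refl

Eval-bit-local : ∀ {n k} {x : Fin n → Cantor} {e : Code k} {xs a} → Eval (orc x) e xs (b2n a) →
                 Σ ℕ λ u → ∀ {x′ a′} → x ≈[ u ] x′ → Eval (orc x′) e xs (b2n a′) → a ≡ a′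
Eval-bit-local d with Eval-local d
... | u , near = u , λ x≈x′ d′ → b2n-injective (Eval-deterministic (near (orc-≈ x≈x′)) d′)

bits-cong : ∀ {l} {y y′ : Fin l → Bool} → (∀ i → y i ≡ y′ i) → bits y ≡ bits y′
bits-cong {zero}  y≗y′ = refl
bits-cong {suc l} y≗y′ = cong₂ _∷_ (cong b2n (y≗y′ fzero)) (bits-cong (y≗y′ ∘ fsuc))

Computes-local : ∀ {n k} {x : Fin n → Cantor} {e : Code 2} {w : Fin k → Cantor} → Computes x e w →
                 ∀ d → Σ ℕ λ u → ∀ {x′ w′} → x ≈[ u ] x′ → Computes x′ e w′ → w ≈[ d ] w′
Computes-local {x = x} {e} {w} comp d =
  proj₁ bound , λ x≈x′ comp′ i j j<d →
    proj₂ (bit i j) (≈[]-mono (≤-trans (proj₂ (row i) j j<d) (proj₂ bound i)) x≈x′) (comp′ i j)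
  where
  bit : ∀ i j → Σ ℕ λ u → ∀ {x′ a′} → x ≈[ u ] x′ →
        Eval (orc x′) e (toℕ i ∷ j ∷ []) (b2n a′) → w i j ≡ a′
  bit i j = Eval-bit-local (comp i j)
  row : ∀ i → Σ ℕ λ U → ∀ j → j < d → proj₁ (bit i j) ≤ U
  row i = <-upper-bound d (proj₁ ∘ bit i)
  bound : Σ ℕ λ U → ∀ i → proj₁ (row i) ≤ U
  bound = Fin-upper-bound (proj₁ ∘ row)

module Reduction {n m k l} {f : Problem n m} {g : Problem k l} (r : f ≤W g) where

  private
    eΦ : Code 2
    eΦ = proj₁ r
    eΨ : Code (suc l)
    eΨ = proj₁ (proj₂ r)
    H : ∀ x → Σ (Fin k → Cantor) λ w → Computes x eΦ w × (∀ y → g w y → Σ (Fin m → Bool) λ z →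
          (∀ j → Eval (orc x) eΨ (toℕ j ∷ bits y) (b2n (z j))) × f x z)
    H = proj₂ (proj₂ r)

  inst : (Fin n → Cantor) → Fin k → Cantor
  inst x = proj₁ (H x)

  inst-computed : ∀ x → Computes x eΦ (inst x)
  inst-computed x = proj₁ (proj₂ (H x))

  answer : ∀ x {y} → g (inst x) y → Fin m → Bool
  answer x {y} gy = proj₁ (proj₂ (proj₂ (H x)) y gy)

  answer-computed : ∀ x {y} (gy : g (inst x) y) j →
                    Eval (orc x) eΨ (toℕ j ∷ bits y) (b2n (answer x gy j))
  answer-computed x {y} gy = proj₁ (proj₂ (proj₂ (proj₂ (H x)) y gy))

  answer-solves : ∀ x {y} (gy : g (inst x) y) → f x (answer x gy)
  answer-solves x {y} gy = proj₂ (proj₂ (proj₂ (proj₂ (H x)) y gy))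

  inst-local : ∀ x d → Σ ℕ λ u → ∀ {x′} → x ≈[ u ] x′ → inst x ≈[ d ] inst x′
  inst-local x d with Computes-local (inst-computed x) d
  ... | u , stable = u , λ {x′} x≈x′ → stable x≈x′ (inst-computed x′)

  answer-local : ∀ x {y} (gy : g (inst x) y) j → Σ ℕ λ u → ∀ {x′ y′} (gy′ : g (inst x′) y′) →
                 x ≈[ u ] x′ → bits y ≡ bits y′ → answer x gy j ≡ answer x′ gy′ j
  answer-local x gy j with Eval-bit-local (answer-computed x gy j)
  ... | u , stable = u , λ {x′} gy′ x≈x′ y≡y′ →
    stable x≈x′ (subst (λ ys → Eval (orc x′) eΨ (toℕ j ∷ ys) _) (sym y≡y′) (answer-computed x′ gy′ j))

<lex-irrefl : ¬ (α <lex α)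
<lex-irrefl (k , _ , αk≡false , αk≡true) = contradiction (trans (sym αk≡false) αk≡true) λ ()

<lex-prefix : ∀ {x x′} (x<α : x <lex α) → x ≈⟨ suc (proj₁ x<α) ⟩ x′ → x′ <lex α
<lex-prefix (k , x≈α , xk≡false , αk≡true) x≈x′ =
  k , (λ j j<k → trans (sym (x≈x′ j (m<n⇒m<1+n j<k))) (x≈α j j<k)) ,
  trans (sym (x≈x′ k ≤-refl)) xk≡false , αk≡true

S-<lex : ∀ {x b} → x <lex α → S α x b → b ≡ false
S-<lex x<α (inj₁ (_ , b≡false)) = b≡false
S-<lex x<α (inj₂ (x≮α , _)) = contradiction x<α x≮α

S-≮lex : ∀ {x b} → ¬ (x <lex α) → S α x b → b ≡ true
S-≮lex x≮α (inj₁ (x<α , _)) = contradiction x<α x≮α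
S-≮lex x≮α (inj₂ (_ , b≡true)) = b≡true

S-functional : ∀ {x b b′} → S α x b → S α x b′ → b ≡ b′
S-functional (inj₁ (x<α , b≡false)) s′ = trans b≡false (sym (S-<lex x<α s′))
S-functional (inj₂ (x≮α , b≡true)) s′ = trans b≡true (sym (S-≮lex x≮α s′))

S-false-local : ∀ {x b} → S α x b →
                Σ ℕ λ d → ∀ {x′ b′} → x ≈⟨ d ⟩ x′ → S α x′ b′ → b ≡ false → b′ ≡ false
S-false-local (inj₁ (x<α , _)) = suc (proj₁ x<α) , λ x≈x′ s′ _ → S-<lex (<lex-prefix x<α x≈x′) s′
S-false-local (inj₂ (_ , refl)) = 0 , λ _ _ ()

SPow-false-local : ∀ {K} {w : Fin K → Cantor} {y} → SPow α K w y →
                   Σ ℕ λ d → ∀ {w′ y′} → w ≈[ d ] w′ → SPow α K w′ y′ → ∀ i → y i ≡ false → y′ i ≡ false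
SPow-false-local sy with Fin-upper-bound (proj₁ ∘ S-false-local ∘ sy)
... | d , ≤d = d , λ w≈w′ sy′ i → proj₂ (S-false-local (sy i)) (≈⟨⟩-mono (≤d i) (w≈w′ i)) (sy′ i)

-- Solutions exist only classically (x <lex α is undecidable), but every argument that uses
-- them proves ⊥, so double-negated existence is enough.
¬¬Total : ∀ {n m} → Problem n m → Set
¬¬Total {n} {m} f = ∀ x → ¬ ¬ Σ (Fin m → Bool) (f x)

S-¬¬total : ∀ α x → ¬ ¬ Σ Bool (S α x)
S-¬¬total α x = ¬¬-map decide ¬¬-excluded-middle
  where
  decide : Dec (x <lex α) → Σ Bool (S α x)
  decide (yes x<α) = false , inj₁ (x<α , refl)
  decide (no x≮α)  = true , inj₂ (x≮α , refl)

SPow-¬¬total : ∀ α m → ¬¬Total (SPow α m)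
SPow-¬¬total α m w =
  ¬¬-map (λ s → proj₁ ∘ s , proj₂ ∘ s) (sequence (RawMonad.rawApplicative ¬¬-Monad) (S-¬¬total α ∘ w))

SXor-¬¬total : ∀ α n → ¬¬Total (SXor α n)
SXor-¬¬total α n x = ¬¬-map (λ (b , sb) → (λ _ → xorAll b) , b , sb , refl) (SPow-¬¬total α n x)

clearBit : ℕ → Cantor → Cantor
clearBit m c j with j ≟ℕ m
... | yes _ = false
... | no _  = c j

clearBit-≈ : ∀ m c → c ≈⟨ m ⟩ clearBit m c
clearBit-≈ m c j j<m with j ≟ℕ m
... | yes refl = contradiction j<m (<-irrefl refl)
... | no _     = refl

clearBit-<lex : ∀ {m} → α m ≡ true → clearBit m α <lex α
clearBit-<lex {α} {m} αm≡true = m , (λ j j<m → sym (clearBit-≈ m α j j<m)) , cleared , αm≡true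
  where
  cleared : clearBit m α m ≡ false
  cleared with m ≟ℕ m
  ... | yes _  = refl
  ... | no m≢m = contradiction refl m≢m

updateAt-≈ : ∀ {n} {x : Fin n → Cantor} {i h} → (∀ c → c ≈⟨ u ⟩ h c) → x ≈[ u ] updateAt x i h
updateAt-≈ {x = x} {i} {h} h≈ i′ with i′ ≟ i
... | yes refl = subst (x i ≈⟨ _ ⟩_) (sym (updateAt-updates i x)) (h≈ (x i))
... | no i′≢i  = λ j _ → cong (λ c → c j) (sym (updateAt-minimal i′ i x i′≢i))

xorAll-cong : ∀ {n} {b b′ : Fin n → Bool} → (∀ i → b i ≡ b′ i) → xorAll b ≡ xorAll b′
xorAll-cong {zero}  b≗b′ = refl
xorAll-cong {suc n} b≗b′ = cong₂ _xor_ (b≗b′ fzero) (xorAll-cong (b≗b′ ∘ fsuc))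

xorAll-updateAt-not : ∀ {n} (b : Fin n → Bool) i → xorAll (updateAt b i not) ≡ not (xorAll b)
xorAll-updateAt-not b fzero    = sym (not-distribˡ-xor (b fzero) _)
xorAll-updateAt-not b (fsuc i) =
  trans (cong (b fzero xor_) (xorAll-updateAt-not (b ∘ fsuc) i)) (sym (not-distribʳ-xor (b fzero) _))

SXor-flip : ∀ {n} {x : Fin n → Cantor} {i h c c′} → ¬ (x i <lex α) → h (x i) <lex α →
            SXor α n x c → SXor α n (updateAt x i h) c′ → c′ fzero ≡ not (c fzero)
SXor-flip {α} {x = x} {i} {h} {c} {c′} xi≮α hxi<α (b , sb , c≡) (b′ , sb′ , c′≡) = begin
  c′ fzero                   ≡⟨ c′≡ ⟩
  xorAll b′                  ≡⟨ xorAll-cong b′≗ ⟩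
  xorAll (updateAt b i not)  ≡⟨ xorAll-updateAt-not b i ⟩
  not (xorAll b)             ≡⟨ cong not (sym c≡) ⟩
  not (c fzero)              ∎
  where
  open ≡-Reasoning
  b′≗ : ∀ j → b′ j ≡ updateAt b i not j
  b′≗ j with j ≟ i
  ... | yes refl = begin
    b′ i                  ≡⟨ S-<lex (subst (_<lex α) (sym (updateAt-updates i x)) hxi<α) (sb′ i) ⟩
    false                 ≡⟨ cong not (sym (S-≮lex xi≮α (sb i))) ⟩
    not (b i)             ≡⟨ sym (updateAt-updates i b) ⟩
    updateAt b i not i    ∎
  ... | no j≢i = begin
    b′ j                  ≡⟨ S-functional (subst (λ c → S α c (b′ j)) (updateAt-minimal j i x j≢i) (sb′ j))
                                          (sb j) ⟩
    b j                   ≡⟨ sym (updateAt-minimal j i b j≢i) ⟩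
    updateAt b i not j    ∎

notCode : Code 1
notCode = cR (cC cS (cZ ∷ [])) cZ

notCode-eval : ∀ a → Eval O notCode (b2n a ∷ []) (b2n (not a))
notCode-eval false = eR0 (eC (eZ ∷ []) eS)
notCode-eval true  = eRS (eR0 (eC (eZ ∷ []) eS)) eZ

xorCode : Code 2
xorCode = cR (cP fzero) (cC notCode (cP (fsuc fzero) ∷ []))

xorCode-eval : ∀ a b → Eval O xorCode (b2n a ∷ b2n b ∷ []) (b2n (a xor b))
xorCode-eval false b = eR0 (eP fzero)
xorCode-eval true  b = eRS (eR0 (eP fzero)) (eC (eP (fsuc fzero) ∷ []) (notCode-eval b))

projections-eval : ∀ {k n} (h : Fin k → Fin n) xs →
                   EvalAll O (tabulate (cP ∘ h)) xs (tabulate (lookup xs ∘ h))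
projections-eval {k = zero}  h xs = []
projections-eval {k = suc k} h xs = eP (h fzero) ∷ projections-eval (h ∘ fsuc) xs

tailCodes : ∀ {n} → Vec (Code (suc n)) n
tailCodes = tabulate (cP ∘ fsuc)

tailCodes-eval : ∀ {n} v (vs : Vec ℕ n) → EvalAll O tailCodes (v ∷ vs) vs
tailCodes-eval {O} v vs =
  subst (EvalAll O tailCodes (v ∷ vs)) (tabulate∘lookup vs) (projections-eval fsuc (v ∷ vs))

parityCode : ∀ n → Code n
parityCode zero    = cZ
parityCode (suc n) = cC xorCode (cP fzero ∷ cC (parityCode n) tailCodes ∷ [])

parityCode-eval : ∀ n (b : Fin n → Bool) → Eval O (parityCode n) (bits b) (b2n (xorAll b))
parityCode-eval zero    b = eZ
parityCode-eval (suc n) b =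
  eC (eP fzero ∷ eC (tailCodes-eval _ _) (parityCode-eval n (b ∘ fsuc)) ∷ []) (xorCode-eval (b fzero) _)

SXor-≤sW-SPow : ∀ α n → SXor α n ≤sW SPow α n
SXor-≤sW-SPow α n =
  cQ , cC (parityCode n) tailCodes , λ x → x , query-computes x , λ y sy →
    (λ _ → xorAll y) , (λ { fzero → eC (tailCodes-eval _ _) (parityCode-eval n y) }) , y , sy , refl
  where
  query-computes : ∀ x → Computes x cQ x
  query-computes x i j = subst (Eval (orc x) cQ (toℕ i ∷ j ∷ [])) (orc-lookup x i j) eQ

no-three-distinct-Bools : (a b c : Bool) → a ≢ b → a ≢ c → b ≢ c → ⊥
no-three-distinct-Bools a b c a≢b a≢c b≢c =
  a≢c (trans (¬-not a≢b) (trans (cong not (¬-not b≢c)) (not-involutive c)))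

module _ (proper : Proper α) {m k} {g : Problem k 1} (g-total : ¬¬Total g)
         (r : SPow α (2 + m) ≤W g) where
  open Reduction r

  answers-differ : ∀ {x x′ y y′} (gy : g (inst x) y) (gy′ : g (inst x′) y′) j →
                   x ≈[ proj₁ (answer-local x gy j) ] x′ → ¬ (x j <lex α) → x′ j <lex α →
                   y fzero ≢ y′ fzero
  answers-differ {x} {x′} gy gy′ j x≈x′ xj≮α x′j<α y≡y′ = contradiction (begin
    true              ≡⟨ sym (S-≮lex xj≮α (answer-solves x gy j)) ⟩
    answer x gy j     ≡⟨ proj₂ (answer-local x gy j) gy′ x≈x′ (cong (λ b → b2n b ∷ []) y≡y′) ⟩
    answer x′ gy′ j   ≡⟨ S-<lex x′j<α (answer-solves x′ gy′ j) ⟩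
    false             ∎) λ ()
    where open ≡-Reasoning

  two-bits-impossible : ⊥
  two-bits-impossible =
    g-total (inst x₀) λ (y₀ , g₀) →
    let u₀ = proj₁ (answer-local x₀ g₀ c₀)
        (m₁ , u₀≤m₁ , αm₁) = proper u₀
        x₁ = updateAt x₀ c₀ (clearBit m₁)
        x₀≈x₁ = updateAt-≈ {i = c₀} (clearBit-≈ m₁)
    in g-total (inst x₁) λ (y₁ , g₁) →
    let u₁ = proj₁ (answer-local x₁ g₁ c₁)
        (m₂ , u₀⊔u₁≤m₂ , αm₂) = proper (u₀ ⊔ u₁)
        x₂ = updateAt x₁ c₁ (clearBit m₂)
        x₁≈x₂ = updateAt-≈ {i = c₁} (clearBit-≈ m₂)
    in g-total (inst x₂) λ (y₂ , g₂) →
    no-three-distinct-Bools (y₀ fzero) (y₁ fzero) (y₂ fzero)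
      (answers-differ g₀ g₁ c₀ (≈[]-mono u₀≤m₁ x₀≈x₁) <lex-irrefl (clearBit-<lex αm₁))
      (answers-differ g₀ g₂ c₀
        (≈[]-trans (≈[]-mono u₀≤m₁ x₀≈x₁) (≈[]-mono (≤-trans (m≤m⊔n u₀ u₁) u₀⊔u₁≤m₂) x₁≈x₂))
        <lex-irrefl (clearBit-<lex αm₁))
      (answers-differ g₁ g₂ c₁ (≈[]-mono (≤-trans (m≤n⊔m u₀ u₁) u₀⊔u₁≤m₂) x₁≈x₂)
        <lex-irrefl (clearBit-<lex αm₂))
    where
    c₀ c₁ : Fin (2 + m)
    c₀ = fzero
    c₁ = fsuc fzero
    x₀ : Fin (2 + m) → Cantor
    x₀ _ = α

SPow-≰W-one-bit : Proper α → ∀ {m k} {g : Problem k 1} → ¬¬Total g → ¬ (SPow α (2 + m) ≤W g)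
SPow-≰W-one-bit = two-bits-impossible

trues : ∀ {K} → (Fin K → Bool) → Subset K
trues = tabulate

∈-trues⁺ : ∀ {K} {y : Fin K → Bool} {i} → y i ≡ true → i ∈ trues y
∈-trues⁺ {y = y} {i} yi≡true = lookup⇒[]= i (trues y) (trans (lookup∘tabulate y i) yi≡true)

∈-trues⁻ : ∀ {K} {y : Fin K → Bool} {i} → i ∈ trues y → y i ≡ true
∈-trues⁻ {y = y} {i} i∈y = trans (sym (lookup∘tabulate y i)) ([]=⇒lookup i∈y)

trues-⊂ : ∀ {K} {y y′ : Fin K → Bool} → (∀ i → y i ≡ false → y′ i ≡ false) → ¬ (∀ i → y i ≡ y′ i) →
          trues y′ ⊂ trues y
trues-⊂ {K} {y} {y′} falses-kept y≢y′ =
  (λ {j} j∈y′ → ∈-trues⁺ (trues-kept j (∈-trues⁻ j∈y′))) , i , ∈-trues⁺ yi≡true ,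
  λ i∈y′ → yi≢y′i (trans yi≡true (sym (∈-trues⁻ i∈y′)))
  where
  trues-kept : ∀ j → y′ j ≡ true → y j ≡ true
  trues-kept j y′j≡true =
    ¬-not λ yj≡false → contradiction (trans (sym y′j≡true) (falses-kept j yj≡false)) λ ()
  witness : Σ (Fin K) λ i → y i ≢ y′ i
  witness = ¬∀⟶∃¬ K (λ i → y i ≡ y′ i) (λ i → y i Bool.≟ y′ i) y≢y′
  i : Fin K
  i = proj₁ witness
  yi≢y′i : y i ≢ y′ i
  yi≢y′i = proj₂ witness
  yi≡true : y i ≡ true
  yi≡true = ¬-not λ yi≡false → yi≢y′i (trans yi≡false (sym (falses-kept i yi≡false)))

module _ (proper : Proper α) {N K} (r : SXor α N ≤W SPow α K) where
  open Reduction r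

  record Stage (k : ℕ) : Set where
    field
      x : Fin N → Cantor
      pristine : ∀ i → k ≤ toℕ i → x i ≡ α
      y : Fin K → Bool
      y-solves : SPow α K (inst x) y
      budget : ∣ trues y ∣ + k ≤ K

  stage₀ : ¬ ¬ Stage 0
  stage₀ = ¬¬-map start (SPow-¬¬total α K (inst λ _ → α))
    where
    start : Σ (Fin K → Bool) (SPow α K (inst λ _ → α)) → Stage 0
    start (y , sy) = record
      { x = λ _ → α ; pristine = λ _ _ → refl ; y = y ; y-solves = sy
      ; budget = subst (_≤ K) (sym (+-identityʳ _)) (∣p∣≤n (trues y)) }

  lowering-loses-a-one : ∀ {x y} (sy : SPow α K (inst x) y) i → x i ≡ α →
    Σ ℕ λ u → ∀ {m y′} → u ≤ m → α m ≡ true →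
              SPow α K (inst (updateAt x i (clearBit m))) y′ → trues y′ ⊂ trues y
  lowering-loses-a-one {x} {y} sy i xi≡α = u-answer ⊔ u-inst , shrinks
    where
    d u-answer u-inst : ℕ
    d = proj₁ (SPow-false-local sy)
    u-answer = proj₁ (answer-local x sy fzero)
    u-inst = proj₁ (inst-local x d)
    shrinks : ∀ {m y′} → u-answer ⊔ u-inst ≤ m → α m ≡ true →
              SPow α K (inst (updateAt x i (clearBit m))) y′ → trues y′ ⊂ trues y
    shrinks {m} {y′} u≤m αm≡true sy′ = trues-⊂ falses-kept y≢y′
      where
      x′ : Fin N → Cantor
      x′ = updateAt x i (clearBit m)
      x≈x′ : x ≈[ m ] x′
      x≈x′ = updateAt-≈ (clearBit-≈ m)
      falses-kept : ∀ j → y j ≡ false → y′ j ≡ false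
      falses-kept = proj₂ (SPow-false-local sy)
        (proj₂ (inst-local x d) (≈[]-mono (≤-trans (m≤n⊔m u-answer u-inst) u≤m) x≈x′)) sy′
      parity-flips : answer x′ sy′ fzero ≡ not (answer x sy fzero)
      parity-flips = SXor-flip {i = i} {h = clearBit m} {c = answer x sy} {c′ = answer x′ sy′}
        (subst (λ c → ¬ (c <lex α)) (sym xi≡α) <lex-irrefl)
        (subst (λ c → clearBit m c <lex α) (sym xi≡α) (clearBit-<lex αm≡true))
        (answer-solves x sy) (answer-solves x′ sy′)
      y≢y′ : ¬ (∀ j → y j ≡ y′ j)
      y≢y′ y≗y′ = not-¬ (sym (proj₂ (answer-local x sy fzero) sy′
        (≈[]-mono (≤-trans (m≤m⊔n u-answer u-inst) u≤m) x≈x′) (bits-cong y≗y′))) parity-flips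

  next-stage : ∀ {k} → k < N → Stage k → ¬ ¬ Stage (suc k)
  next-stage {k} k<N s = ¬¬-map advance (SPow-¬¬total α K (inst x′))
    where
    open Stage s
    i : Fin N
    i = fromℕ< k<N
    lowering : Σ ℕ λ u → ∀ {m y′} → u ≤ m → α m ≡ true →
               SPow α K (inst (updateAt x i (clearBit m))) y′ → trues y′ ⊂ trues y
    lowering = lowering-loses-a-one y-solves i (pristine i (≤-reflexive (sym (toℕ-fromℕ< k<N))))
    far-one : Σ ℕ λ m → proj₁ lowering ≤ m × α m ≡ true
    far-one = proper (proj₁ lowering)
    m : ℕ
    m = proj₁ far-one
    x′ : Fin N → Cantor
    x′ = updateAt x i (clearBit m)
    pristine′ : ∀ j → suc k ≤ toℕ j → x′ j ≡ α
    pristine′ j k<j = trans (updateAt-minimal j i x j≢i) (pristine j (<⇒≤ k<j))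
      where
      j≢i : j ≢ i
      j≢i refl = <-irrefl (sym (toℕ-fromℕ< k<N)) k<j
    advance : Σ (Fin K → Bool) (SPow α K (inst x′)) → Stage (suc k)
    advance (y′ , sy′) = record
      { x = x′ ; pristine = pristine′ ; y = y′ ; y-solves = sy′
      ; budget = ≤-trans (≤-reflexive (+-suc _ k)) (≤-trans (+-monoˡ-≤ k (p⊂q⇒∣p∣<∣q∣ shrinks)) budget) }
      where
      shrinks : trues y′ ⊂ trues y
      shrinks = proj₂ lowering (proj₁ (proj₂ far-one)) (proj₂ (proj₂ far-one)) sy′

  stage : ∀ k → k ≤ N → ¬ ¬ Stage k
  stage zero    _   = stage₀
  stage (suc k) k<N ¬s = stage k (<⇒≤ k<N) λ s → next-stage k<N s ¬s

  no-final-stage : K < N → ¬ Stage N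
  no-final-stage K<N s = <⇒≱ K<N (≤-trans (m≤n+m N _) (Stage.budget s))

SXor-≰W-SPow : Proper α → ∀ {N K} → K < N → ¬ (SXor α N ≤W SPow α K)
SXor-≰W-SPow proper K<N r = stage proper r _ ≤-refl (no-final-stage proper r K<N)

mainTheorem8 : ∀ (α : Cantor) → Proper α → ∀ (n : ℕ) → 2 ≤ n →
    ¬ (SXor α n ≤W SPow α (n ∸ 1))
    × (SXor α n ≤sW SPow α n)
    × ¬ (SPow α n ≤W SXor α n)
    × ¬ (SPow α 2 ≤W SXor α n)
mainTheorem8 α proper (suc (suc n)) (s≤s (s≤s z≤n)) =
    SXor-≰W-SPow proper ≤-refl
  , SXor-≤sW-SPow α (2 + n)
  , SPow-≰W-one-bit proper (SXor-¬¬total α (2 + n))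
  , SPow-≰W-one-bit proper (SXor-¬¬total α (2 + n))
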